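{- Let $m$ be a positive integer. For every graph $G$, $$\bar{\chi}_{m-1}(G)+1\le \bar{\chi}_{m}(G)\le \bar{\chi}_{m-1}(G)+\chi(G)\le (m+1)\chi(G).$$ In addition, for every positive integer $p\ge m$ and every complete multipartite graph $G$ all of whose parts have size $\binom{p}{m}$, $$\min\Big\{\chi(G)+\Big(1-\tfrac{1}{m+1}\Big)p,\ (m+1)\chi(G)\Big\}\le \bar{\chi}_{m}(G).$$
   Context: For a graph $G$, a mapping $L: V(G)\to 2^{\mathbb{Z}}$ and a positive integer $k$, $G$ is $L$-avoiding $k$-colorable if there is a proper coloring $c: V(G)\to \{1,\dots,k\}$ with $c(v)\notin L(v)$ for every vertex $v$. For a nonnegative integer $m$, the $m$-avoiding chromatic number $\bar{\chi}_m(G)$ is the minimum $k$ such that $G$ is $L$-avoiding $k$-colorable for every mapping $L: V(G)\to 2^{\mathbb{Z}}$ with $|L(v)|\le m$ for all $v$. In particular $\bar{\chi}_0(G)=\chi(G)$, the chromatic number. -}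

module Defs where

open import Data.Nat using (ℕ; suc; _≤_; _<_)
open import Data.Nat.Combinatorics using (_C_)
open import Data.Fin using (Fin; toℕ)
open import Data.Integer using (ℤ; +_)
open import Data.List using (List; length)
open import Data.List.Membership.Propositional using (_∉_)
open import Data.Product using (_×_; Σ; ∃; _,_)
open import Relation.Nullary using (¬_)
open import Relation.Binary.PropositionalEquality using (_≡_; _≢_)

record Graph (V : Set) : Set₁ where
  field
    Adj    : V → V → Set
    sym    : ∀ {u v} → Adj u v → Adj v u
    irrefl : ∀ {v} → ¬ Adj v v
open Graph public

-- A coloring with k colors; Fin k element i stands for the color (i + 1) ∈ {1,…,k}.
Coloring : Set → ℕ → Set
Coloring V k = V → Fin k

colorValue : ∀ {k} → Fin k → ℤ
colorValue i = + suc (toℕ i)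

Proper : ∀ {V} → Graph V → ∀ {k} → Coloring V k → Set
Proper G c = ∀ u v → Adj G u v → c u ≢ c v

-- A mapping L : V → (finite) subsets of ℤ, represented by lists.
Avoids : ∀ {V k} → (V → List ℤ) → Coloring V k → Set
Avoids L c = ∀ v → colorValue (c v) ∉ L v

LAvoidingColorable : ∀ {V} → Graph V → (V → List ℤ) → ℕ → Set
LAvoidingColorable {V} G L k = Σ (Coloring V k) λ c → Proper G c × Avoids L c

Bounded : ∀ {V} → ℕ → (V → List ℤ) → Set
Bounded m L = ∀ v → length (L v) ≤ m

MAvoidingColorable : ∀ {V} → ℕ → Graph V → ℕ → Set
MAvoidingColorable {V} m G k =
  (L : V → List ℤ) → Bounded m L → LAvoidingColorable G L k

IsAvoidingChromaticNumber : ∀ {V} → ℕ → Graph V → ℕ → Set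
IsAvoidingChromaticNumber m G k =
  MAvoidingColorable m G k × (∀ j → j < k → ¬ MAvoidingColorable m G j)

Colorable : ∀ {V} → Graph V → ℕ → Set
Colorable {V} G k = Σ (Coloring V k) λ c → Proper G c

IsChromaticNumber : ∀ {V} → Graph V → ℕ → Set
IsChromaticNumber G k = Colorable G k × (∀ j → j < k → ¬ Colorable G j)

completeMultipartite : (r s : ℕ) → Graph (Fin r × Fin s)
completeMultipartite r s = record
  { Adj    = λ { (i , _) (j , _) → i ≢ j }
  ; sym    = λ { ne eq → ne (symm eq) }
  ; irrefl = λ ne → ne reflexive
  }
  where
  open import Relation.Binary.PropositionalEquality using () renaming (sym to symm; refl to reflexive)

-- Upper bounds: shorten every list by one entry, dropping an entry above a if there is one,
-- colour avoiding the shortened lists with colours 1,…,a, and recolour every vertex whose colour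
-- lies in its full list by a + φ(v) for a proper χ-colouring φ. Forbidding the top colour
-- everywhere turns an m-avoiding b-colouring into an (m-1)-avoiding (b-1)-colouring.
--
-- Lower bound: let the vertices of each part forbid the m-subsets of {1,…,p}. A part all of whose
-- colours lie in {1,…,p} uses at least m + 1 colours, as any m of them are forbidden at some
-- vertex. If every part is like that, (m + 1) χ ≤ (m + 1) r ≤ b. Otherwise b > p, and
-- (m + 1) r + m p ≤ (m + 1) b by an injection into m + 1 copies of the colours: copy 0 takes
-- m + 1 colours of every part of the first kind and one colour of every other part, while each
-- further copy takes the colours 1,…,p and one colour above p of every other part.
module Submission where

open import Defs hiding (sym)
open import Data.Nat using (ℕ; suc; _+_; _*_; _∸_; _≤_; _⊓_)
open import Data.Nat.Combinatorics using (_C_)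
open import Data.Fin using (Fin)
open import Data.Product using (_×_)

open import Data.Nat using (zero; z≤n; s≤s; s≤s⁻¹; _<_; _<?_)
open import Data.Nat.Properties
open import Data.Nat.Combinatorics using (nCk+nC[k+1]≡[n+1]C[k+1])
open import Data.Fin as Fin
  using (toℕ; fromℕ<; inject≤; lower₁; _↑ˡ_; _↑ʳ_; splitAt; join; cast)
import Data.Fin.Properties as Finₚ
open import Data.Integer as ℤ using (ℤ; +_)
import Data.Integer.Properties as ℤₚ
open import Data.List using (List; []; _∷_; length; map; filter; tabulate)
import Data.List.Properties as Listₚ
open import Data.List.Relation.Unary.All as All using (All)
open import Data.List.Relation.Unary.All.Properties.Core using (¬All⇒Any¬)
open import Data.List.Relation.Unary.Any using (here; there; any?)
open import Data.List.Relation.Binary.Subset.Propositional using (_⊆_)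
open import Data.List.Membership.Propositional using (_∈_; _∉_)
open import Data.List.Membership.Propositional.Properties using (∈-map⁺; ∈-filter⁺; ∈-tabulate⁺)
open import Data.List.Membership.DecPropositional ℤₚ._≟_ using (_∈?_)
open import Data.Product using (Σ; ∃; _,_; proj₁; proj₂)
open import Data.Sum using (_⊎_; inj₁; inj₂; [_,_]′)
open import Data.Sum.Properties using (inj₁-injective; inj₂-injective)
open import Data.Sum.Function.Propositional using (_⊎-↔_)
open import Data.Empty using (⊥-elim)
open import Relation.Nullary using (¬_; Dec; yes; no; contradiction)
open import Relation.Binary.PropositionalEquality
open import Function using (_∘_)
open import Function.Bundles using (_↔_; Injection; mk↣)
open import Function.Definitions using (Injective)
open import Function.Properties.Inverse using (↔⇒↣; ↔-sym; ↔-refl; ↔-trans)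
open import Function.Properties.Injection using (↣-trans)

least-≤ : ∀ {P : ℕ → Set} {a j} → (∀ i → i < a → ¬ P i) → P j → a ≤ j
least-≤ {a = a} {j} below Pj with j <? a
... | yes j<a = contradiction Pj (below j j<a)
... | no j≮a = ≮⇒≥ j≮a

injection⇒≤ : ∀ {A B : Set} {m n} → Fin m ↔ A → Fin n ↔ B →
              (f : A → B) → Injective _≡_ _≡_ f → m ≤ n
injection⇒≤ A↔ B↔ f f-injective =
  Finₚ.injective⇒≤ (Injection.injective (↣-trans (↣-trans (↔⇒↣ A↔) (mk↣ f-injective)) (↔⇒↣ (↔-sym B↔))))

join-injective : ∀ m n → Injective _≡_ _≡_ (join m n)
join-injective m n {x} {y} eq = begin
  x                      ≡⟨ Finₚ.splitAt-join m n x ⟨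
  splitAt m (join m n x) ≡⟨ cong (splitAt m) eq ⟩
  splitAt m (join m n y) ≡⟨ Finₚ.splitAt-join m n y ⟩
  y                      ∎
  where open ≡-Reasoning

colorValue-cong : ∀ {k l} {x : Fin k} {y : Fin l} → toℕ x ≡ toℕ y → colorValue x ≡ colorValue y
colorValue-cong = cong (+_ ∘ suc)

ShortenedKeepingBelow : ℕ → ℤ → List ℤ → Set
ShortenedKeepingBelow k bound xs =
  ∃ λ ys → length ys ≤ k × (All (ℤ._≤ bound) xs ⊎ (∀ {x} → x ∈ xs → x ℤ.≤ bound → x ∈ ys))

shortenKeepingBelow : ∀ {k} (bound : ℤ) (xs : List ℤ) → length xs ≤ suc k →
                      ShortenedKeepingBelow k bound xs
shortenKeepingBelow bound [] _ = [] , z≤n , inj₁ All.[]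
shortenKeepingBelow {k} bound (x ∷ xs) (s≤s len) with All.all? (ℤ._≤? bound) (x ∷ xs)
... | yes allBelow = xs , len , inj₁ allBelow
... | no notAllBelow = filter (ℤ._≤? bound) (x ∷ xs) , shorter , inj₂ (∈-filter⁺ (ℤ._≤? bound))
  where
  shorter : length (filter (ℤ._≤? bound) (x ∷ xs)) ≤ k
  shorter = s≤s⁻¹ (≤-trans (Listₚ.filter-notAll (ℤ._≤? bound) (x ∷ xs)
                     (¬All⇒Any¬ (ℤ._≤? bound) (x ∷ xs) notAllBelow)) (s≤s len))

module _ {V : Set} (G : Graph V) where

  ¬MAvoidingColorable-0 : ∀ {k} → V → ¬ MAvoidingColorable k G 0
  ¬MAvoidingColorable-0 v colorable with () ← proj₁ (colorable (λ _ → []) (λ _ → z≤n)) v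

  MAvoidingColorable-pred : ∀ {k b} → MAvoidingColorable (suc k) G (suc b) → MAvoidingColorable k G b
  MAvoidingColorable-pred {b = b} colorable L bounded =
    (λ v → lower₁ (c v) (top-unused v)) , lowered-proper , lowered-avoids
    where
    withTop : V → List ℤ
    withTop v = + suc b ∷ L v
    coloring : LAvoidingColorable G withTop (suc b)
    coloring = colorable withTop (s≤s ∘ bounded)
    c : Coloring V (suc b)
    c = proj₁ coloring
    top-unused : ∀ v → b ≢ toℕ (c v)
    top-unused v eq = proj₂ (proj₂ coloring) v (here (cong (+_ ∘ suc) (sym eq)))
    lowered-proper : Proper G (λ v → lower₁ (c v) (top-unused v))
    lowered-proper u v adj = proj₁ (proj₂ coloring) u v adj ∘ Finₚ.lower₁-injective
    lowered-avoids : Avoids L (λ v → lower₁ (c v) (top-unused v))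
    lowered-avoids v x∈ = proj₂ (proj₂ coloring) v
      (there (subst (_∈ L v) (colorValue-cong (Finₚ.toℕ-lower₁ (c v) (top-unused v))) x∈))

  MAvoidingColorable-0 : ∀ {χ} → Colorable G χ → MAvoidingColorable 0 G χ
  MAvoidingColorable-0 (φ , φ-proper) L bounded = φ , φ-proper , λ v → empty (L v) (bounded v)
    where
    empty : ∀ {x} (xs : List ℤ) → length xs ≤ 0 → x ∉ xs
    empty [] _ ()

  MAvoidingColorable-suc : ∀ {χ k a} → Colorable G χ → MAvoidingColorable k G a →
                           MAvoidingColorable (suc k) G (a + χ)
  MAvoidingColorable-suc {χ} {k} {a} (φ , φ-proper) colorable L bounded =
    join a χ ∘ choice , joined-proper , joined-avoids
    where
    shortened : ∀ v → ShortenedKeepingBelow k (+ a) (L v)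
    shortened v = shortenKeepingBelow (+ a) (L v) (bounded v)
    coloring : LAvoidingColorable G (proj₁ ∘ shortened) a
    coloring = colorable (proj₁ ∘ shortened) (proj₁ ∘ proj₂ ∘ shortened)
    c : Coloring V a
    c = proj₁ coloring
    choice : V → Fin a ⊎ Fin χ
    choice v with colorValue (c v) ∈? L v
    ... | yes _ = inj₂ (φ v)
    ... | no _ = inj₁ (c v)
    choice-proper : ∀ u v → Adj G u v → choice u ≢ choice v
    choice-proper u v adj with colorValue (c u) ∈? L u | colorValue (c v) ∈? L v
    ... | yes _ | yes _ = φ-proper u v adj ∘ inj₂-injective
    ... | no _ | no _ = proj₁ (proj₂ coloring) u v adj ∘ inj₁-injective
    ... | yes _ | no _ = λ ()
    ... | no _ | yes _ = λ ()
    joined-proper : Proper G (join a χ ∘ choice)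
    joined-proper u v adj = choice-proper u v adj ∘ join-injective a χ
    joined-avoids : Avoids L (join a χ ∘ choice)
    joined-avoids v with colorValue (c v) ∈? L v | proj₂ (proj₂ (shortened v))
    ... | no ∉L | _ = subst (_∉ L v) (colorValue-cong (sym (Finₚ.toℕ-↑ˡ (c v) χ))) ∉L
    ... | yes ∈L | inj₂ keeps =
      ⊥-elim (proj₂ (proj₂ coloring) v (keeps ∈L (ℤ.+≤+ (Finₚ.toℕ<n (c v)))))
    ... | yes ∈L | inj₁ allBelow =
      λ ∈L′ → <⇒≱ recolored-above (ℤₚ.drop‿+≤+ (All.lookup allBelow ∈L′))
      where
      recolored-above : a < suc (toℕ (a ↑ʳ φ v))
      recolored-above = s≤s (≤-trans (m≤m+n a _) (≤-reflexive (sym (Finₚ.toℕ-↑ʳ a (φ v)))))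

  MAvoidingColorable-mul : ∀ {χ} → Colorable G χ → ∀ k → MAvoidingColorable k G ((k + 1) * χ)
  MAvoidingColorable-mul {χ} colorable zero =
    subst (MAvoidingColorable 0 G) (sym (*-identityˡ χ)) (MAvoidingColorable-0 colorable)
  MAvoidingColorable-mul {χ} colorable (suc k) =
    subst (MAvoidingColorable (suc k) G) (+-comm _ χ)
      (MAvoidingColorable-suc colorable (MAvoidingColorable-mul colorable k))

  avoidingChromatic-suc-> : ∀ {k a b} → V → IsAvoidingChromaticNumber k G a →
                            IsAvoidingChromaticNumber (suc k) G b → a + 1 ≤ b
  avoidingChromatic-suc-> {b = zero} v _ hsk = contradiction (proj₁ hsk) (¬MAvoidingColorable-0 v)
  avoidingChromatic-suc-> {a = a} {suc b} v hk hsk =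
    subst (_≤ suc b) (+-comm 1 a) (s≤s (least-≤ (proj₂ hk) (MAvoidingColorable-pred (proj₁ hsk))))

  avoidingChromatic-suc-≤ : ∀ {k a b χ} → IsChromaticNumber G χ → IsAvoidingChromaticNumber k G a →
                            IsAvoidingChromaticNumber (suc k) G b → b ≤ a + χ
  avoidingChromatic-suc-≤ hχ hk hsk = least-≤ (proj₂ hsk) (MAvoidingColorable-suc (proj₁ hχ) (proj₁ hk))

  avoidingChromatic-≤ : ∀ {k a χ} → IsChromaticNumber G χ → IsAvoidingChromaticNumber k G a →
                        a ≤ (k + 1) * χ
  avoidingChromatic-≤ {k} hχ ha = least-≤ (proj₂ ha) (MAvoidingColorable-mul (proj₁ hχ) k)

binomial : ℕ → ℕ → ℕ
binomial _ zero = 1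
binomial zero (suc k) = 0
binomial (suc n) (suc k) = binomial n k + binomial n (suc k)

binomial≡C : ∀ n k → binomial n k ≡ n C k
binomial≡C n zero = refl
binomial≡C zero (suc k) = refl
binomial≡C (suc n) (suc k) =
  trans (cong₂ _+_ (binomial≡C n k) (binomial≡C n (suc k))) (nCk+nC[k+1]≡[n+1]C[k+1] n k)

-- The m-subsets of {0,…,p-1}, listed by Pascal's rule: those containing 0, then the others.
subsetList : ∀ p m → Fin (binomial p m) → List (Fin p)
subsetList p zero _ = []
subsetList (suc p) (suc m) x =
  [ (λ y → Fin.zero ∷ map Fin.suc (subsetList p m y)) , map Fin.suc ∘ subsetList p (suc m) ]′
    (splitAt (binomial p m) x)

length-subsetList : ∀ p m x → length (subsetList p m x) ≤ m
length-subsetList p zero _ = z≤n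
length-subsetList (suc p) (suc m) x with splitAt (binomial p m) x
... | inj₁ y = s≤s (≤-trans (≤-reflexive (Listₚ.length-map Fin.suc (subsetList p m y)))
                          (length-subsetList p m y))
... | inj₂ y = ≤-trans (≤-reflexive (Listₚ.length-map Fin.suc (subsetList p (suc m) y)))
                     (length-subsetList p (suc m) y)

subsetList-↑ˡ : ∀ p m y →
  subsetList (suc p) (suc m) (y ↑ˡ binomial p (suc m)) ≡ Fin.zero ∷ map Fin.suc (subsetList p m y)
subsetList-↑ˡ p m y rewrite Finₚ.splitAt-↑ˡ (binomial p m) y (binomial p (suc m)) = refl

subsetList-↑ʳ : ∀ p m y →
  subsetList (suc p) (suc m) (binomial p m ↑ʳ y) ≡ map Fin.suc (subsetList p (suc m) y)
subsetList-↑ʳ p m y rewrite Finₚ.splitAt-↑ʳ (binomial p m) (binomial p (suc m)) y = refl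

predecessors : ∀ {p} → List (Fin (suc p)) → List (Fin p)
predecessors [] = []
predecessors (Fin.zero ∷ xs) = predecessors xs
predecessors (Fin.suc x ∷ xs) = x ∷ predecessors xs

length-predecessors : ∀ {p} (xs : List (Fin (suc p))) → length (predecessors xs) ≤ length xs
length-predecessors [] = z≤n
length-predecessors (Fin.zero ∷ xs) = m≤n⇒m≤1+n (length-predecessors xs)
length-predecessors (Fin.suc x ∷ xs) = s≤s (length-predecessors xs)

length-predecessors-< : ∀ {p} (xs : List (Fin (suc p))) → Fin.zero ∈ xs →
                        length (predecessors xs) < length xs
length-predecessors-< (Fin.zero ∷ xs) (here refl) = s≤s (length-predecessors xs)
length-predecessors-< (Fin.zero ∷ xs) (there 0∈) = m≤n⇒m≤1+n (length-predecessors-< xs 0∈)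
length-predecessors-< (Fin.suc x ∷ xs) (there 0∈) = s≤s (length-predecessors-< xs 0∈)

∈-predecessors : ∀ {p} {x : Fin p} (xs : List (Fin (suc p))) → Fin.suc x ∈ xs → x ∈ predecessors xs
∈-predecessors (Fin.zero ∷ xs) (there x∈) = ∈-predecessors xs x∈
∈-predecessors (Fin.suc x ∷ xs) (here refl) = here refl
∈-predecessors (Fin.suc y ∷ xs) (there x∈) = there (∈-predecessors xs x∈)

⊆-zero∷map-suc : ∀ {p} (xs : List (Fin (suc p))) {ys} → predecessors xs ⊆ ys →
                 xs ⊆ Fin.zero ∷ map Fin.suc ys
⊆-zero∷map-suc xs sub {Fin.zero} _ = here refl
⊆-zero∷map-suc xs sub {Fin.suc x} x∈ = there (∈-map⁺ Fin.suc (sub (∈-predecessors xs x∈)))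

⊆-map-suc : ∀ {p} (xs : List (Fin (suc p))) {ys} → Fin.zero ∉ xs → predecessors xs ⊆ ys →
            xs ⊆ map Fin.suc ys
⊆-map-suc xs 0∉ sub {Fin.zero} 0∈ = contradiction 0∈ 0∉
⊆-map-suc xs 0∉ sub {Fin.suc x} x∈ = ∈-map⁺ Fin.suc (sub (∈-predecessors xs x∈))

subsetList-full : ∀ p (xs : List (Fin p)) → ∃ λ y → xs ⊆ subsetList p p y
subsetList-full zero xs = Fin.zero , λ {x} _ → ⊥-elim (Finₚ.¬Fin0 x)
subsetList-full (suc p) xs with subsetList-full p (predecessors xs)
... | y , sub = y ↑ˡ binomial p (suc p) ,
                subst (xs ⊆_) (sym (subsetList-↑ˡ p p y)) (⊆-zero∷map-suc xs sub)

subsetList-covers : ∀ {p m} → m ≤ p → (xs : List (Fin p)) → length xs ≤ m →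
                    ∃ λ y → xs ⊆ subsetList p m y
subsetList-covers {m = zero} _ [] _ = Fin.zero , λ ()
subsetList-covers {suc p} {suc m} (s≤s m≤p) xs len with any? (Fin.zero Finₚ.≟_) xs
... | yes 0∈
  with subsetList-covers m≤p (predecessors xs) (s≤s⁻¹ (≤-trans (length-predecessors-< xs 0∈) len))
...   | y , sub = y ↑ˡ binomial p (suc m) ,
                  subst (xs ⊆_) (sym (subsetList-↑ˡ p m y)) (⊆-zero∷map-suc xs sub)
subsetList-covers {suc p} {suc m} (s≤s m≤p) xs len | no 0∉ with m≤n⇒m<n∨m≡n m≤p
... | inj₂ refl = subsetList-full (suc p) xs
... | inj₁ m<p with subsetList-covers m<p (predecessors xs) (≤-trans (length-predecessors xs) len)
...   | y , sub = binomial p m ↑ʳ y ,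
                  subst (xs ⊆_) (sym (subsetList-↑ʳ p m y)) (⊆-map-suc xs 0∉ sub)

mSubset : ∀ p m → Fin (p C m) → List (Fin p)
mSubset p m = subsetList p m ∘ cast (sym (binomial≡C p m))

mSubset-covers : ∀ {p m} → m ≤ p → (xs : List (Fin p)) → length xs ≤ m → ∃ λ y → xs ⊆ mSubset p m y
mSubset-covers {p} {m} m≤p xs len with subsetList-covers m≤p xs len
... | y , sub = cast (binomial≡C p m) y ,
                subst (λ z → xs ⊆ subsetList p m z)
                      (sym (Finₚ.cast-involutive (sym (binomial≡C p m)) (binomial≡C p m) y)) sub

-- The points are chosen greedily, each with an image outside those of the previous ones.
fresh⇒injection : ∀ {A B : Set} {m} (h : A → B) → (∀ ys → length ys ≤ m → ∃ λ a → h a ∉ ys) →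
                  ∀ n → n ≤ suc m → Σ (Fin n → A) λ f → Injective _≡_ _≡_ (h ∘ f)
fresh⇒injection h fresh zero _ = (λ ()) , λ { {()} }
fresh⇒injection h fresh (suc n) (s≤s n≤m)
  with f , f-injective ← fresh⇒injection h fresh n (m≤n⇒m≤1+n n≤m)
  with a , a-fresh ← fresh (tabulate (h ∘ f)) (≤-trans (≤-reflexive (Listₚ.length-tabulate _)) n≤m)
  = extended , extended-injective
  where
  extended : Fin (suc n) → _
  extended Fin.zero = a
  extended (Fin.suc j) = f j
  extended-injective : Injective _≡_ _≡_ (h ∘ extended)
  extended-injective {Fin.zero} {Fin.zero} _ = refl
  extended-injective {Fin.zero} {Fin.suc j} eq =
    contradiction (subst (_∈ tabulate (h ∘ f)) (sym eq) (∈-tabulate⁺ j)) a-fresh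
  extended-injective {Fin.suc i} {Fin.zero} eq =
    contradiction (subst (_∈ tabulate (h ∘ f)) eq (∈-tabulate⁺ i)) a-fresh
  extended-injective {Fin.suc i} {Fin.suc j} eq = cong Fin.suc (f-injective eq)

multipartite-colorable : ∀ r s → Colorable (completeMultipartite r s) r
multipartite-colorable r s = proj₁ , λ u v adj → adj

sameColor⇒samePart : ∀ {r s b} {c : Coloring (Fin r × Fin s) b} → Proper (completeMultipartite r s) c →
                     ∀ {i i′ a a′} → c (i , a) ≡ c (i′ , a′) → i ≡ i′
sameColor⇒samePart proper {i} {i′} {a} {a′} eq with i Finₚ.≟ i′
... | yes i≡i′ = i≡i′
... | no i≢i′ = contradiction eq (proper (i , a) (i′ , a′) i≢i′)

subsetLists : ∀ {r} m p → Fin r × Fin (p C m) → List ℤ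
subsetLists m p (_ , a) = map colorValue (mSubset p m a)

subsetLists-bounded : ∀ {r} m p → Bounded {Fin r × Fin (p C m)} m (subsetLists m p)
subsetLists-bounded m p (_ , a) =
  ≤-trans (≤-reflexive (Listₚ.length-map colorValue (mSubset p m a))) (length-subsetList p m _)

module SubsetListColoring {m p r b : ℕ} (m≤p : m ≤ p) (c : Coloring (Fin r × Fin (p C m)) b)
  (proper : Proper (completeMultipartite r (p C m)) c) (avoids : Avoids (subsetLists m p) c) where

  Rainbow : Fin r → Set
  Rainbow i = Σ (Fin (suc m) → Fin (p C m)) λ f → Injective _≡_ _≡_ (λ j → c (i , f j))

  low⇒rainbow : ∀ i → (∀ a → toℕ (c (i , a)) < p) → Rainbow i
  low⇒rainbow i low = proj₁ distinct , λ eq → proj₂ distinct (Finₚ.fromℕ<-cong _ _ (cong toℕ eq) _ _)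
    where
    lowColor : Fin (p C m) → Fin p
    lowColor a = fromℕ< (low a)
    fresh : ∀ ys → length ys ≤ m → ∃ λ a → lowColor a ∉ ys
    fresh ys len with y , sub ← mSubset-covers m≤p ys len =
      y , λ ∈ys → avoids (i , y) (subst (_∈ subsetLists m p (i , y))
                                        (colorValue-cong (Finₚ.toℕ-fromℕ< (low y)))
                                        (∈-map⁺ colorValue (sub ∈ys)))
    distinct : Σ (Fin (suc m) → Fin (p C m)) λ f → Injective _≡_ _≡_ (lowColor ∘ f)
    distinct = fresh⇒injection lowColor fresh (suc m) ≤-refl

  data Spread (i : Fin r) : Set where
    rainbow : Rainbow i → Spread i
    high : (a : Fin (p C m)) → p ≤ toℕ (c (i , a)) → Spread i

  spread : ∀ i → Spread i
  spread i with Finₚ.all? (λ a → toℕ (c (i , a)) <? p)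
  ... | yes low = rainbow (low⇒rainbow i low)
  ... | no ¬low with a , a-high ← Finₚ.¬∀⟶∃¬ _ _ (λ a → toℕ (c (i , a)) <? p) ¬low =
    high a (≮⇒≥ a-high)

  rainbows-≤ : (∀ i a → toℕ (c (i , a)) < p) → r * suc m ≤ b
  rainbows-≤ low = injection⇒≤ Finₚ.*↔× ↔-refl colorOf colorOf-injective
    where
    colorOf : Fin r × Fin (suc m) → Fin b
    colorOf (i , j) = c (i , proj₁ (low⇒rainbow i (low i)) j)
    colorOf-injective : Injective _≡_ _≡_ colorOf
    colorOf-injective {i , j} {i′ , j′} eq with refl ← sameColor⇒samePart proper eq =
      cong (i ,_) (proj₂ (low⇒rainbow i (low i)) eq)

  level : ∀ {i} → Spread i → Fin (suc m) → Fin (suc m)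
  level (rainbow _) _ = Fin.zero
  level (high _ _) j = j

  vertex : ∀ {i} → Spread i → Fin (suc m) → Fin (p C m)
  vertex (rainbow (f , _)) j = f j
  vertex (high a _) _ = a

  slot : ∀ {i} → Spread i → Fin (suc m) → Fin (suc m) × Fin b
  slot {i} σ j = level σ j , c (i , vertex σ j)

  slot-injective : ∀ {i} (σ : Spread i) → Injective _≡_ _≡_ (slot σ)
  slot-injective (rainbow (_ , f-injective)) eq = f-injective (cong proj₂ eq)
  slot-injective (high _ _) eq = cong proj₁ eq

  slot-high : ∀ {i} (σ : Spread i) j {j′} → level σ j ≡ Fin.suc j′ → p ≤ toℕ (c (i , vertex σ j))
  slot-high (high _ a-high) _ _ = a-high

  ¬low⇒p<b : ¬ (∀ i a → toℕ (c (i , a)) < p) → p < b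
  ¬low⇒p<b ¬low
    with i , ¬low-i ← Finₚ.¬∀⟶∃¬ r _ (λ i → Finₚ.all? (λ a → toℕ (c (i , a)) <? p)) ¬low
    with a , ¬low-a ← Finₚ.¬∀⟶∃¬ _ _ (λ a → toℕ (c (i , a)) <? p) ¬low-i
    = ≤-<-trans (≮⇒≥ ¬low-a) (Finₚ.toℕ<n (c (i , a)))

  mixed-≤ : p < b → r * suc m + m * p ≤ suc m * b
  mixed-≤ p<b =
    injection⇒≤ (↔-trans Finₚ.+↔⊎ (Finₚ.*↔× ⊎-↔ Finₚ.*↔×)) Finₚ.*↔× place place-injective
    where
    place : Fin r × Fin (suc m) ⊎ Fin m × Fin p → Fin (suc m) × Fin b
    place (inj₁ (i , j)) = slot (spread i) j
    place (inj₂ (j , q)) = Fin.suc j , inject≤ q (<⇒≤ p<b)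
    low≢high : ∀ i j j′ q → slot (spread i) j ≢ (Fin.suc j′ , inject≤ q (<⇒≤ p<b))
    low≢high i j j′ q eq = <⇒≱ (subst (_< p) (sym (Finₚ.toℕ-inject≤ q _)) (Finₚ.toℕ<n q))
      (subst (p ≤_) (cong (toℕ ∘ proj₂) eq) (slot-high (spread i) j (cong proj₁ eq)))
    place-injective : Injective _≡_ _≡_ place
    place-injective {inj₁ (i , j)} {inj₁ (i′ , j′)} eq
      with refl ← sameColor⇒samePart proper (cong proj₂ eq) = cong (inj₁ ∘ (i ,_)) (slot-injective (spread i) eq)
    place-injective {inj₁ (i , j)} {inj₂ (j′ , q)} eq = contradiction eq (low≢high i j j′ q)
    place-injective {inj₂ (j , q)} {inj₁ (i , j′)} eq = contradiction (sym eq) (low≢high i j′ j q)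
    place-injective {inj₂ (j , q)} {inj₂ (j′ , q′)} eq =
      cong₂ (λ x y → inj₂ (x , y)) (Finₚ.suc-injective (cong proj₁ eq))
                                   (Finₚ.inject≤-injective _ _ q q′ (cong proj₂ eq))

multipartite-bound : ∀ {m p r χ b} → m ≤ p →
  IsChromaticNumber (completeMultipartite r (p C m)) χ →
  IsAvoidingChromaticNumber m (completeMultipartite r (p C m)) b →
  ((m + 1) * χ + m * p) ⊓ ((m + 1) * ((m + 1) * χ)) ≤ (m + 1) * b
multipartite-bound {m} {p} {r} {χ} {b} m≤p hχ hb rewrite +-comm m 1 =
  bound (Finₚ.all? (λ i → Finₚ.all? (λ a → toℕ (c (i , a)) <? p)))
  where
  coloring : LAvoidingColorable (completeMultipartite r (p C m)) (subsetLists m p) b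
  coloring = proj₁ hb (subsetLists m p) (subsetLists-bounded m p)
  c : Coloring (Fin r × Fin (p C m)) b
  c = proj₁ coloring
  open SubsetListColoring m≤p c (proj₁ (proj₂ coloring)) (proj₂ (proj₂ coloring))
  χ≤r : suc m * χ ≤ r * suc m
  χ≤r = ≤-trans (*-monoʳ-≤ (suc m) (least-≤ (proj₂ hχ) (multipartite-colorable r (p C m))))
                (≤-reflexive (*-comm (suc m) r))
  bound : Dec (∀ i a → toℕ (c (i , a)) < p) →
          (suc m * χ + m * p) ⊓ (suc m * (suc m * χ)) ≤ suc m * b
  bound (yes low) = ≤-trans (m⊓n≤n _ _) (*-monoʳ-≤ (suc m) (≤-trans χ≤r (rainbows-≤ low)))
  bound (no ¬low) =
    ≤-trans (m⊓n≤m _ _) (≤-trans (+-monoˡ-≤ (m * p) χ≤r) (mixed-≤ (¬low⇒p<b ¬low)))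

mainTheorem12 : (m : ℕ) → 1 ≤ m →
    ((n : ℕ) → 1 ≤ n → (G : Graph (Fin n)) → (χ a b : ℕ) →
      IsChromaticNumber G χ →
      IsAvoidingChromaticNumber (m ∸ 1) G a →
      IsAvoidingChromaticNumber m G b →
      (a + 1 ≤ b) × (b ≤ a + χ) × (a + χ ≤ (m + 1) * χ))
    ×
    ((p : ℕ) → m ≤ p → (r χ b : ℕ) →
      IsChromaticNumber (completeMultipartite r (p C m)) χ →
      IsAvoidingChromaticNumber m (completeMultipartite r (p C m)) b →
      (((m + 1) * χ + m * p) ⊓ ((m + 1) * ((m + 1) * χ)) ≤ (m + 1) * b))
mainTheorem12 (suc _) _ =
    (λ { (suc _) _ G χ a b hχ ha hb →
           avoidingChromatic-suc-> G Fin.zero ha hb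
         , avoidingChromatic-suc-≤ G hχ ha hb
         , ≤-trans (+-monoˡ-≤ χ (avoidingChromatic-≤ G hχ ha)) (≤-reflexive (+-comm _ χ)) })
  , λ _ m≤p _ _ _ → multipartite-bound m≤p
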